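{- For every positive integer $k$, as rational functions in $x$ (the left side being the power series expansion of the right side), \[ \sum_{n\ge1}\left|\mathrm{Alt}^{\le k+1}_n\right|x^n=\cfrac{ -y}{y-b_0-\cfrac{ -1}{y-b_1-\cfrac{ -1}{y-b_2-\cdots-\cfrac{ -1}{y-b_k}}}}, \] where $y=(-1)^kx$, $b_0=(-1)^k$, and $b_i=2(-1)^{k-i}$ for $1\le i\le k$.
   Context: $\mathrm{Alt}^{\le K}_n$ is the set of integer sequences $(a_1,\dots,a_n)$ with $a_1\le a_2\ge a_3\le a_4\ge\cdots$ and $1\le a_i\le K$ for all $i$. -}

module Defs where

open import Data.Nat as ℕ using (ℕ; zero; suc; _≤ᵇ_; _<_)
open import Data.Integer as ℤ using (ℤ; +_; 0ℤ; 1ℤ; -_)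
open import Data.Bool using (Bool; true; false; _∧_)
open import Data.List using (List; []; _∷_; map; concatMap; length)
open import Data.Product using (_×_; _,_; proj₁; proj₂; ∃)
open import Relation.Binary.PropositionalEquality using (_≡_; _≢_)

altFrom : Bool → List ℕ → Bool
altFrom up []           = true
altFrom up (a ∷ [])     = true
altFrom true  (a ∷ b ∷ r) = (a ≤ᵇ b) ∧ altFrom false (b ∷ r)
altFrom false (a ∷ b ∷ r) = (b ≤ᵇ a) ∧ altFrom true  (b ∷ r)

isAlt : List ℕ → Bool
isAlt = altFrom true

range1 : ℕ → List ℕ
range1 zero    = []
range1 (suc K) = go K
  where
  go : ℕ → List ℕ
  go zero    = 1 ∷ []
  go (suc m) = 1 ∷ map suc (go m)

seqs : ℕ → ℕ → List (List ℕ)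
seqs K zero    = [] ∷ []
seqs K (suc n) = concatMap (λ a → map (a ∷_) (seqs K n)) (range1 K)

countWhere : {A : Set} → (A → Bool) → List A → ℕ
countWhere P []       = 0
countWhere P (a ∷ as) with P a
... | true  = suc (countWhere P as)
... | false = countWhere P as

altCount : ℕ → ℕ → ℕ
altCount K n = countWhere isAlt (seqs K n)

-- Polynomials over ℤ : coefficient lists, lowest degree first.

Poly : Set
Poly = List ℤ

coeff : Poly → ℕ → ℤ
coeff []       _       = 0ℤ
coeff (c ∷ _)  zero    = c
coeff (_ ∷ cs) (suc i) = coeff cs i

_⊕_ : Poly → Poly → Poly
[]       ⊕ q        = q
(a ∷ p)  ⊕ []       = a ∷ p
(a ∷ p)  ⊕ (b ∷ q)  = (a ℤ.+ b) ∷ (p ⊕ q)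

scale : ℤ → Poly → Poly
scale c = map (c ℤ.*_)

_⊗_ : Poly → Poly → Poly
[]      ⊗ q = []
(a ∷ p) ⊗ q = scale a q ⊕ (0ℤ ∷ (p ⊗ q))

NonZeroPoly : Poly → Set
NonZeroPoly p = ∃ λ i → coeff p i ≢ 0ℤ

Series : Set
Series = ℕ → ℤ

polyTimesSeries : Poly → Series → ℕ → ℤ
polyTimesSeries p f n = go n n
  where
  go : ℕ → ℕ → ℤ
  go zero    m = coeff p 0 ℤ.* f m
  go (suc j) m = coeff p (suc j) ℤ.* f (m ℕ.∸ suc j) ℤ.+ go j m

-- The continued fraction, evaluated with literal (unreduced) fraction
-- arithmetic on pairs (numerator , denominator) of polynomials.

sgn : ℕ → ℤ
sgn zero          = 1ℤ
sgn (suc zero)    = - 1ℤ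
sgn (suc (suc m)) = sgn m

yPoly : ℕ → Poly
yPoly k = 0ℤ ∷ sgn k ∷ []

bCoef : ℕ → ℕ → ℤ
bCoef k zero    = sgn k
bCoef k (suc i) = + 2 ℤ.* sgn (k ℕ.∸ suc i)

yMinusB : ℕ → ℕ → Poly
yMinusB k i = yPoly k ⊕ ((ℤ.- bCoef k i) ∷ [])

Frac : Set
Frac = Poly × Poly   -- (numerator , denominator)

-- tailCF k j  is the tail  T_{k-j}  of the continued fraction:
--   T_k = y - b_k ,   T_i = y - b_i - (-1) / T_{i+1}
-- With T_{i+1} = p / q we have  T_i = ((y - b_i) p + q) / p .
tailCF : ℕ → ℕ → Frac
tailCF k zero    = yMinusB k k , (1ℤ ∷ [])
tailCF k (suc j) with tailCF k j
... | p , q = ((yMinusB k (k ℕ.∸ suc j) ⊗ p) ⊕ q) , p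

-- the whole continued fraction  -y / (y - b_0 - (-1)/T_1),  with T_1 = tailCF k (k - 1)
--   = (-y · p) / ((y - b_0) p + q)   where T_1 = p / q
contFrac : ℕ → Frac
contFrac k with tailCF k (k ℕ.∸ 1)
... | p , q = (scale (- 1ℤ) (yPoly k) ⊗ p) , ((yMinusB k 0 ⊗ p) ⊕ q)

altGF : ℕ → Series
altGF K zero    = 0ℤ
altGF K (suc n) = + altCount K (suc n)

-- Write K = k + 1 and let F n m count the sequences s ∈ [1, K]ⁿ with m ≥ s₁ ≤ s₂ ≥ ⋯.
-- The reflection a ↦ K + 1 − a exchanges sequences starting with an ascent and with a
-- descent, which yields the Pascal-type recurrence F (n+1) (m+1) = F (n+1) m + F n (K − m),
-- and |Alt^{≤K}_{n+1}| = F (n+1) K. Consequently the differences of F across the windows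
-- [⌈i/2⌉, K − ⌊i/2⌋], which shrink alternately from either end, satisfy a second-order
-- recurrence in i; suitably signed, their generating series Wᵢ obey the three-term
-- recurrence (y − bᵢ) Wᵢ = Wᵢ₊₁ − Wᵢ₋₁ of the continued fraction, with W₀ the generating
-- function divided by x and W_{k+1} = 0 because that window is a single point.
-- Eliminating W_k, W_{k−1}, … from the top expresses each ratio Wᵢ / Wᵢ₊₁ through a tail
-- of the continued fraction, and at i = 0 this is the claimed identity. The partial
-- numerators and denominators are nonzero because their leading coefficients are ±1.

module Submission where

open import Defs
open import Data.Nat as ℕ using (ℕ; zero; suc; _∸_; _≤_; _<_; _≤ᵇ_; _≡ᵇ_; z≤n; s≤s; ⌊_/2⌋; ⌈_/2⌉)
open import Data.Nat.ListAction using (sum)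
open import Data.Nat.Properties as ℕ using ()
open import Algebra.Properties.CommutativeSemigroup ℕ.+-commutativeSemigroup using () renaming (interchange to +-interchange)
open import Data.Integer as ℤ using (ℤ; 0ℤ; 1ℤ; -1ℤ; -_; _+_; _-_; _*_; ∣_∣)
open import Data.Integer.Properties
  using (+-identityˡ; +-identityʳ; +-comm; +-inverseʳ; *-zeroˡ; *-zeroʳ; *-identityˡ; *-identityʳ; -1*i≡-i; abs-*; pos-+)
open import Data.Integer.Tactic.RingSolver using (solve-∀)
open import Data.Bool using (Bool; true; false; _∧_)
open import Data.List using (List; []; _∷_; _++_; map; concatMap)
open import Data.List.Properties using (map-∘; map-cong)
open import Data.Product using (_×_; _,_; proj₁; proj₂)
open import Function using (_∘_)
open import Relation.Binary.PropositionalEquality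


-- Polynomials acting on power series

shift : Series → Series
shift f zero    = 0ℤ
shift f (suc n) = f n

δ : Series
δ zero    = 1ℤ
δ (suc n) = 0ℤ

infixr 7 _⊛_

_⊛_ : Poly → Series → Series
([]    ⊛ f) n = 0ℤ
((a ∷ p) ⊛ f) n = a * f n + shift (p ⊛ f) n

shift-cong : ∀ {f g} → f ≗ g → shift f ≗ shift g
shift-cong f≗g zero    = refl
shift-cong f≗g (suc n) = f≗g n

shift-+ : ∀ f g → shift (λ n → f n + g n) ≗ λ n → shift f n + shift g n
shift-+ f g zero    = refl
shift-+ f g (suc n) = refl

shift-* : ∀ c f → shift (λ n → c * f n) ≗ λ n → c * shift f n
shift-* c f zero    = sym (*-zeroʳ c)
shift-* c f (suc n) = refl

shift-zero : shift (λ _ → 0ℤ) ≗ λ _ → 0ℤ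
shift-zero zero    = refl
shift-zero (suc n) = refl

⊛-cong : ∀ p {f g} → f ≗ g → p ⊛ f ≗ p ⊛ g
⊛-cong []      f≗g n = refl
⊛-cong (a ∷ p) f≗g n = cong₂ (λ u v → a * u + v) (f≗g n) (shift-cong (⊛-cong p f≗g) n)

⊛-zero : ∀ p → p ⊛ (λ _ → 0ℤ) ≗ λ _ → 0ℤ
⊛-zero []      n       = refl
⊛-zero (a ∷ p) zero    = cong (_+ 0ℤ) (*-zeroʳ a)
⊛-zero (a ∷ p) (suc n) = cong₂ _+_ (*-zeroʳ a) (⊛-zero p n)

⊛-+ : ∀ p f g → p ⊛ (λ n → f n + g n) ≗ λ n → (p ⊛ f) n + (p ⊛ g) n
⊛-+ []      f g n = refl
⊛-+ (a ∷ p) f g n = begin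
  a * (f n + g n) + shift (p ⊛ (λ m → f m + g m)) n
    ≡⟨ cong (a * (f n + g n) +_) (trans (shift-cong (⊛-+ p f g) n) (shift-+ (p ⊛ f) (p ⊛ g) n)) ⟩
  a * (f n + g n) + (shift (p ⊛ f) n + shift (p ⊛ g) n)
    ≡⟨ distrib a (f n) (g n) _ _ ⟩
  (a * f n + shift (p ⊛ f) n) + (a * g n + shift (p ⊛ g) n) ∎
  where
  open ≡-Reasoning
  distrib : ∀ a x y u v → a * (x + y) + (u + v) ≡ (a * x + u) + (a * y + v)
  distrib = solve-∀

⊛-* : ∀ p c f → p ⊛ (λ n → c * f n) ≗ λ n → c * (p ⊛ f) n
⊛-* []      c f n = sym (*-zeroʳ c)
⊛-* (a ∷ p) c f n = begin
  a * (c * f n) + shift (p ⊛ (λ m → c * f m)) n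
    ≡⟨ cong (a * (c * f n) +_) (trans (shift-cong (⊛-* p c f) n) (shift-* c (p ⊛ f) n)) ⟩
  a * (c * f n) + c * shift (p ⊛ f) n
    ≡⟨ factor a c (f n) _ ⟩
  c * (a * f n + shift (p ⊛ f) n) ∎
  where
  open ≡-Reasoning
  factor : ∀ a c x u → a * (c * x) + c * u ≡ c * (a * x + u)
  factor = solve-∀

⊛-neg : ∀ p f → p ⊛ (λ n → - f n) ≗ λ n → - (p ⊛ f) n
⊛-neg p f n = begin
  (p ⊛ (λ m → - f m)) n      ≡⟨ ⊛-cong p (λ m → sym (-1*i≡-i (f m))) n ⟩
  (p ⊛ (λ m → -1ℤ * f m)) n  ≡⟨ ⊛-* p -1ℤ f n ⟩
  -1ℤ * (p ⊛ f) n            ≡⟨ -1*i≡-i _ ⟩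
  - (p ⊛ f) n                ∎
  where open ≡-Reasoning

⊛-− : ∀ p f g → p ⊛ (λ n → f n - g n) ≗ λ n → (p ⊛ f) n - (p ⊛ g) n
⊛-− p f g n = trans (⊛-+ p f (λ m → - g m) n) (cong ((p ⊛ f) n +_) (⊛-neg p g n))

⊛-shift : ∀ p f → p ⊛ shift f ≗ shift (p ⊛ f)
⊛-shift []      f zero    = refl
⊛-shift []      f (suc n) = refl
⊛-shift (a ∷ p) f zero    = cong (_+ 0ℤ) (*-zeroʳ a)
⊛-shift (a ∷ p) f (suc n) = cong (a * f n +_) (⊛-shift p f n)

⊕-⊛ : ∀ p q f → (p ⊕ q) ⊛ f ≗ λ n → (p ⊛ f) n + (q ⊛ f) n
⊕-⊛ []      q       f n = sym (+-identityˡ _)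
⊕-⊛ (a ∷ p) []      f n = sym (+-identityʳ _)
⊕-⊛ (a ∷ p) (b ∷ q) f n = begin
  (a + b) * f n + shift ((p ⊕ q) ⊛ f) n
    ≡⟨ cong ((a + b) * f n +_) (trans (shift-cong (⊕-⊛ p q f) n) (shift-+ (p ⊛ f) (q ⊛ f) n)) ⟩
  (a + b) * f n + (shift (p ⊛ f) n + shift (q ⊛ f) n)
    ≡⟨ distrib a b (f n) _ _ ⟩
  (a * f n + shift (p ⊛ f) n) + (b * f n + shift (q ⊛ f) n) ∎
  where
  open ≡-Reasoning
  distrib : ∀ a b x u v → (a + b) * x + (u + v) ≡ (a * x + u) + (b * x + v)
  distrib = solve-∀

scale-⊛ : ∀ c p f → scale c p ⊛ f ≗ λ n → c * (p ⊛ f) n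
scale-⊛ c []      f n = sym (*-zeroʳ c)
scale-⊛ c (a ∷ p) f n = begin
  (c * a) * f n + shift (scale c p ⊛ f) n
    ≡⟨ cong ((c * a) * f n +_) (trans (shift-cong (scale-⊛ c p f) n) (shift-* c (p ⊛ f) n)) ⟩
  (c * a) * f n + c * shift (p ⊛ f) n
    ≡⟨ factor c a (f n) _ ⟩
  c * (a * f n + shift (p ⊛ f) n) ∎
  where
  open ≡-Reasoning
  factor : ∀ c a x u → (c * a) * x + c * u ≡ c * (a * x + u)
  factor = solve-∀

⊗-⊛ : ∀ p q f → (p ⊗ q) ⊛ f ≗ p ⊛ (q ⊛ f)
⊗-⊛ []      q f n = refl
⊗-⊛ (a ∷ p) q f n = begin
  ((scale a q ⊕ (0ℤ ∷ p ⊗ q)) ⊛ f) n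
    ≡⟨ ⊕-⊛ (scale a q) (0ℤ ∷ p ⊗ q) f n ⟩
  (scale a q ⊛ f) n + (0ℤ * f n + shift ((p ⊗ q) ⊛ f) n)
    ≡⟨ cong₂ _+_ (scale-⊛ a q f n) (trans (cong (_+ shift ((p ⊗ q) ⊛ f) n) (*-zeroˡ (f n))) (+-identityˡ _)) ⟩
  a * (q ⊛ f) n + shift ((p ⊗ q) ⊛ f) n
    ≡⟨ cong (a * (q ⊛ f) n +_) (shift-cong (⊗-⊛ p q f) n) ⟩
  a * (q ⊛ f) n + shift (p ⊛ (q ⊛ f)) n ∎
  where open ≡-Reasoning

⊛-comm : ∀ p q f → p ⊛ (q ⊛ f) ≗ q ⊛ (p ⊛ f)
⊛-comm []      q f n = sym (⊛-zero q n)
⊛-comm (a ∷ p) q f n = begin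
  a * (q ⊛ f) n + shift (p ⊛ (q ⊛ f)) n
    ≡⟨ cong (a * (q ⊛ f) n +_) (shift-cong (⊛-comm p q f) n) ⟩
  a * (q ⊛ f) n + shift (q ⊛ (p ⊛ f)) n
    ≡⟨ sym (cong₂ _+_ (⊛-* q a f n) (⊛-shift q (p ⊛ f) n)) ⟩
  (q ⊛ (λ m → a * f m)) n + (q ⊛ shift (p ⊛ f)) n
    ≡⟨ sym (⊛-+ q (λ m → a * f m) (shift (p ⊛ f)) n) ⟩
  (q ⊛ ((a ∷ p) ⊛ f)) n ∎
  where open ≡-Reasoning

coeff≗⊛δ : ∀ p → coeff p ≗ p ⊛ δ
coeff≗⊛δ []      n       = refl
coeff≗⊛δ (a ∷ p) zero    = sym (trans (+-identityʳ _) (*-identityʳ a))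
coeff≗⊛δ (a ∷ p) (suc n) = trans (coeff≗⊛δ p n) (sym (trans (cong (_+ _) (*-zeroʳ a)) (+-identityˡ _)))

coeff-⊗ : ∀ p q → coeff (p ⊗ q) ≗ p ⊛ coeff q
coeff-⊗ p q n = begin
  coeff (p ⊗ q) n      ≡⟨ coeff≗⊛δ (p ⊗ q) n ⟩
  ((p ⊗ q) ⊛ δ) n      ≡⟨ ⊗-⊛ p q δ n ⟩
  (p ⊛ (q ⊛ δ)) n      ≡⟨ ⊛-cong p (λ m → sym (coeff≗⊛δ q m)) n ⟩
  (p ⊛ coeff q) n      ∎
  where open ≡-Reasoning

partialConv : Poly → Series → ℕ → ℕ → ℤ
partialConv p f zero    m = coeff p 0 * f m
partialConv p f (suc j) m = coeff p (suc j) * f (m ∸ suc j) + partialConv p f j m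

partialConv-unique : ∀ p f (g : ℕ → ℕ → ℤ) →
  (∀ m → g zero m ≡ coeff p 0 * f m) →
  (∀ j m → g (suc j) m ≡ coeff p (suc j) * f (m ∸ suc j) + g j m) →
  ∀ j m → g j m ≡ partialConv p f j m
partialConv-unique p f g g-zero g-suc zero    m = g-zero m
partialConv-unique p f g g-zero g-suc (suc j) m =
  trans (g-suc j m) (cong (coeff p (suc j) * f (m ∸ suc j) +_) (partialConv-unique p f g g-zero g-suc j m))

polyTimesSeries≡partialConv : ∀ p f n → polyTimesSeries p f n ≡ partialConv p f n n
polyTimesSeries≡partialConv p f zero    = refl
polyTimesSeries≡partialConv p f (suc n)
  -- The inner summation of polyTimesSeries has no name; abstracting n and suc n to
  -- variables lets the unifier solve g with it.
  with partialConv-unique p f _ (λ _ → refl) (λ _ _ → refl) | n | suc n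
... | go≡partialConv | j | m = cong (coeff p m * f (j ∸ j) +_) (go≡partialConv j m)

partialConv-[] : ∀ f j m → partialConv [] f j m ≡ 0ℤ
partialConv-[] f zero    m = refl
partialConv-[] f (suc j) m = trans (+-identityˡ _) (partialConv-[] f j m)

partialConv-∷ : ∀ a p f j m →
  partialConv (a ∷ p) f (suc j) (suc m) ≡ a * f (suc m) + partialConv p f j m
partialConv-∷ a p f zero    m = +-comm (coeff p 0 * f m) (a * f (suc m))
partialConv-∷ a p f (suc j) m =
  trans (cong (coeff p (suc j) * f (m ∸ suc j) +_) (partialConv-∷ a p f j m))
        (swap (coeff p (suc j) * f (m ∸ suc j)) (a * f (suc m)) (partialConv p f j m))
  where
  swap : ∀ x y z → x + (y + z) ≡ y + (x + z)
  swap = solve-∀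

⊛≡partialConv : ∀ p f n → (p ⊛ f) n ≡ partialConv p f n n
⊛≡partialConv []      f n       = sym (partialConv-[] f n n)
⊛≡partialConv (a ∷ p) f zero    = +-identityʳ _
⊛≡partialConv (a ∷ p) f (suc n) =
  trans (cong (a * f (suc n) +_) (⊛≡partialConv p f n)) (sym (partialConv-∷ a p f n n))

polyTimesSeries≗⊛ : ∀ p f → polyTimesSeries p f ≗ p ⊛ f
polyTimesSeries≗⊛ p f n = trans (polyTimesSeries≡partialConv p f n) (sym (⊛≡partialConv p f n))

linear-⊛ : ∀ a b f → (a ∷ b ∷ []) ⊛ f ≗ λ n → a * f n + shift (λ m → b * f m) n
linear-⊛ a b f n = cong (a * f n +_) (shift-cong (λ m → trans (cong (b * f m +_) (shift-zero m)) (+-identityʳ _)) n)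

constant-⊛ : ∀ a f → (a ∷ []) ⊛ f ≗ λ n → a * f n
constant-⊛ a f n = trans (cong (a * f n +_) (shift-zero n)) (+-identityʳ _)

yMinusB-⊛ : ∀ k i f → yMinusB k i ⊛ f ≗ λ n → - bCoef k i * f n + shift (λ m → sgn k * f m) n
yMinusB-⊛ k i f n = trans (linear-⊛ (0ℤ + - bCoef k i) (sgn k) f n) 
  (cong (λ c → c * f n + shift (λ m → sgn k * f m) n) (+-identityˡ (- bCoef k i)))

yMinusB-⊛-tail : ∀ k i (v r : Series) → (∀ n → sgn k * v n + - bCoef k i * v (suc n) ≡ r n) →
  yMinusB k i ⊛ (λ n → v (suc n)) ≗ λ n → r n - sgn k * v 0 * δ n
yMinusB-⊛-tail k i v r relation n = trans (yMinusB-⊛ k i (λ m → v (suc m)) n) (at n)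
  where
  at : ∀ n → - bCoef k i * v (suc n) + shift (λ m → sgn k * v (suc m)) n ≡ r n - sgn k * v 0 * δ n
  at zero    rewrite sym (relation zero) = ring (sgn k) (- bCoef k i) (v 0) (v 1)
    where
    ring : ∀ s b x y → b * y + 0ℤ ≡ s * x + b * y - s * x * 1ℤ
    ring = solve-∀
  at (suc n) rewrite sym (relation (suc n)) = ring (sgn k) (- bCoef k i) (v 0) (v (suc n)) (v (suc (suc n)))
    where
    ring : ∀ s b x y z → b * z + s * y ≡ s * y + b * z - s * x * 0ℤ
    ring = solve-∀

coeff-negY⊗ : ∀ k p → coeff (scale (- 1ℤ) (yPoly k) ⊗ p) ≗ shift (λ m → - (sgn k * coeff p m))
coeff-negY⊗ k p n =
  trans (coeff-⊗ (scale (- 1ℤ) (yPoly k)) p n) (trans (linear-⊛ 0ℤ (- 1ℤ * sgn k) (coeff p) n) (at n))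
  where
  at : ∀ n → 0ℤ * coeff p n + shift (λ m → - 1ℤ * sgn k * coeff p m) n ≡ shift (λ m → - (sgn k * coeff p m)) n
  at zero    = ring (coeff p 0)
    where
    ring : ∀ x → 0ℤ * x + 0ℤ ≡ 0ℤ
    ring = solve-∀
  at (suc n) = ring (sgn k) (coeff p (suc n)) (coeff p n)
    where
    ring : ∀ s x y → 0ℤ * x + - 1ℤ * s * y ≡ - (s * y)
    ring = solve-∀


-- The continued fraction

tailNum tailDen : ℕ → ℕ → Poly
tailNum k j = proj₁ (tailCF k j)
tailDen k j = proj₂ (tailCF k j)

module Elimination (k : ℕ) (W : ℕ → Series)
  (three-term : ∀ i → i < k → yMinusB k (suc i) ⊛ W (suc i) ≗ λ n → W (suc (suc i)) n - W i n)
  (W-top : W (suc k) ≗ λ _ → 0ℤ)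
  where

  tail-ratio : ∀ j i → i ℕ.+ suc j ≡ k → tailDen k j ⊛ W i ≗ λ n → - (tailNum k j ⊛ W (suc i)) n
  tail-ratio zero i i+1≡k n = begin
    ((1ℤ ∷ []) ⊛ W i) n                         ≡⟨ trans (constant-⊛ 1ℤ (W i) n) (*-identityˡ _) ⟩
    W i n                                        ≡⟨ negate-0- (W i n) ⟩
    - (0ℤ - W i n)                               ≡⟨ cong (λ w → - (w - W i n)) (sym (W-top n)) ⟩
    - (W (suc k) n - W i n)                      ≡⟨ cong (λ t → - (W (suc t) n - W i n)) (sym 1+i≡k) ⟩
    - (W (suc (suc i)) n - W i n)                ≡⟨ cong -_ (sym (three-term i (ℕ.≤-reflexive 1+i≡k) n)) ⟩
    - (yMinusB k (suc i) ⊛ W (suc i)) n          ≡⟨ cong (λ t → - (yMinusB k t ⊛ W (suc i)) n) 1+i≡k ⟩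
    - (yMinusB k k ⊛ W (suc i)) n                ∎
    where
    open ≡-Reasoning
    1+i≡k : suc i ≡ k
    1+i≡k = trans (ℕ.+-comm 1 i) i+1≡k
    negate-0- : ∀ x → x ≡ - (0ℤ - x)
    negate-0- = solve-∀
  tail-ratio (suc j) i i+2+j≡k n = begin
    (P ⊛ W i) n
      ≡⟨ cancel ((P ⊛ W (suc (suc i))) n) ((P ⊛ W i) n) ⟩
    - ((P ⊛ W (suc (suc i))) n - (P ⊛ W i) n + - (P ⊛ W (suc (suc i))) n)
      ≡⟨ cong₂ (λ u v → - (u + v)) (sym (⊛-− P (W (suc (suc i))) (W i) n))
                                    (sym (tail-ratio j (suc i) 1+i+1+j≡k n)) ⟩
    - ((P ⊛ (λ m → W (suc (suc i)) m - W i m)) n + (Q ⊛ W (suc i)) n)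
      ≡⟨ cong (λ u → - (u + (Q ⊛ W (suc i)) n)) (sym (⊛-cong P (three-term i i<k) n)) ⟩
    - ((P ⊛ (Y ⊛ W (suc i))) n + (Q ⊛ W (suc i)) n)
      ≡⟨ cong (λ u → - (u + (Q ⊛ W (suc i)) n))
              (trans (⊛-comm P Y (W (suc i)) n) (sym (⊗-⊛ Y P (W (suc i)) n))) ⟩
    - (((Y ⊗ P) ⊛ W (suc i)) n + (Q ⊛ W (suc i)) n)
      ≡⟨ cong -_ (sym (⊕-⊛ (Y ⊗ P) Q (W (suc i)) n)) ⟩
    - (((Y ⊗ P) ⊕ Q) ⊛ W (suc i)) n
      ≡⟨ cong (λ t → - (((yMinusB k t ⊗ P) ⊕ Q) ⊛ W (suc i)) n) (sym k∸[1+j]≡1+i) ⟩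
    - (tailNum k (suc j) ⊛ W (suc i)) n ∎
    where
    open ≡-Reasoning
    P = tailNum k j
    Q = tailDen k j
    Y = yMinusB k (suc i)
    1+i+1+j≡k : suc i ℕ.+ suc j ≡ k
    1+i+1+j≡k = trans (sym (ℕ.+-suc i (suc j))) i+2+j≡k
    k∸[1+j]≡1+i : k ∸ suc j ≡ suc i
    k∸[1+j]≡1+i = trans (cong (_∸ suc j) (sym 1+i+1+j≡k)) (ℕ.m+n∸n≡m (suc i) (suc j))
    i<k : i < k
    i<k = subst (suc i ℕ.≤_) 1+i+1+j≡k (ℕ.m≤m+n (suc i) (suc j))
    cancel : ∀ a b → b ≡ - ((a - b) + - a)
    cancel = solve-∀

  denominator-⊛ : ∀ j → suc j ≡ k →
    (yMinusB k 0 ⊛ W 0 ≗ λ n → W 1 n - sgn k * δ n) →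
    ((yMinusB k 0 ⊗ tailNum k j) ⊕ tailDen k j) ⊛ W 0 ≗ λ n → - (sgn k * coeff (tailNum k j) n)
  denominator-⊛ j 1+j≡k base n = begin
    (((Y ⊗ P) ⊕ Q) ⊛ W 0) n
      ≡⟨ ⊕-⊛ (Y ⊗ P) Q (W 0) n ⟩
    ((Y ⊗ P) ⊛ W 0) n + (Q ⊛ W 0) n
      ≡⟨ cong₂ _+_ (trans (⊗-⊛ Y P (W 0) n) (⊛-comm Y P (W 0) n)) (tail-ratio j 0 1+j≡k n) ⟩
    (P ⊛ (Y ⊛ W 0)) n + - (P ⊛ W 1) n
      ≡⟨ cong (_+ - (P ⊛ W 1) n) (⊛-cong P base n) ⟩
    (P ⊛ (λ m → W 1 m - sgn k * δ m)) n + - (P ⊛ W 1) n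
      ≡⟨ cong (_+ - (P ⊛ W 1) n)
              (trans (⊛-− P (W 1) (λ m → sgn k * δ m) n) (cong (λ c → (P ⊛ W 1) n - c) (⊛-* P (sgn k) δ n))) ⟩
    (P ⊛ W 1) n - sgn k * (P ⊛ δ) n + - (P ⊛ W 1) n
      ≡⟨ cancel ((P ⊛ W 1) n) (sgn k * (P ⊛ δ) n) ⟩
    - (sgn k * (P ⊛ δ) n)
      ≡⟨ cong (λ c → - (sgn k * c)) (sym (coeff≗⊛δ P n)) ⟩
    - (sgn k * coeff P n) ∎
    where
    open ≡-Reasoning
    P = tailNum k j
    Q = tailDen k j
    Y = yMinusB k 0
    cancel : ∀ a c → a - c + - a ≡ - c
    cancel = solve-∀


sgn-suc : ∀ m → sgn (suc m) ≡ - sgn m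
sgn-suc zero          = refl
sgn-suc (suc zero)    = refl
sgn-suc (suc (suc m)) = sgn-suc m

sgn-+ : ∀ m n → sgn (m ℕ.+ n) ≡ sgn m * sgn n
sgn-+ zero          n = sym (*-identityˡ (sgn n))
sgn-+ (suc zero)    n = trans (sgn-suc n) (sym (-1*i≡-i (sgn n)))
sgn-+ (suc (suc m)) n = sgn-+ m n

sgn-square : ∀ m → sgn m * sgn m ≡ 1ℤ
sgn-square zero          = refl
sgn-square (suc zero)    = refl
sgn-square (suc (suc m)) = sgn-square m

sgn-∸ : ∀ {m n} → n ≤ m → sgn (m ∸ n) * sgn n ≡ sgn m
sgn-∸ {m} {n} n≤m = trans (sym (sgn-+ (m ∸ n) n)) (cong sgn (ℕ.m∸n+n≡m n≤m))

data EvenOdd : ℕ → Set where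
  even : ∀ j → EvenOdd (j ℕ.+ j)
  odd  : ∀ j → EvenOdd (suc (j ℕ.+ j))

evenOdd : ∀ n → EvenOdd n
evenOdd zero    = even zero
evenOdd (suc n) with evenOdd n
... | even j = odd j
... | odd  j = subst EvenOdd (cong suc (ℕ.+-suc j j)) (even (suc j))

sgn-even : ∀ j → sgn (j ℕ.+ j) ≡ 1ℤ
sgn-even j = trans (sgn-+ j j) (sgn-square j)

∣sgn∣≡1 : ∀ m → ∣ sgn m ∣ ≡ 1
∣sgn∣≡1 zero          = refl
∣sgn∣≡1 (suc zero)    = refl
∣sgn∣≡1 (suc (suc m)) = ∣sgn∣≡1 m

VanishesAbove : ℕ → Poly → Set
VanishesAbove d p = ∀ t → d < t → coeff p t ≡ 0ℤ

record UnitLeading (d : ℕ) (p : Poly) : Set where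
  constructor unitLeading
  field
    ∣leading∣≡1 : ∣ coeff p d ∣ ≡ 1
    vanishes    : VanishesAbove d p

unitLeading⇒nonZero : ∀ {d p} → UnitLeading d p → NonZeroPoly p
unitLeading⇒nonZero {d} (unitLeading ∣leading∣≡1 _) =
  d , λ leading≡0 → ℕ.1+n≢0 (trans (sym ∣leading∣≡1) (cong ∣_∣ leading≡0))

coeff-⊕ : ∀ p q t → coeff (p ⊕ q) t ≡ coeff p t + coeff q t
coeff-⊕ []      q       t       = sym (+-identityˡ _)
coeff-⊕ (a ∷ p) []      t       = sym (+-identityʳ _)
coeff-⊕ (a ∷ p) (b ∷ q) zero    = refl
coeff-⊕ (a ∷ p) (b ∷ q) (suc t) = coeff-⊕ p q t

coeff-yMinusB-⊗ : ∀ k i p t →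
  coeff (yMinusB k i ⊗ p) (suc t) ≡ - bCoef k i * coeff p (suc t) + sgn k * coeff p t
coeff-yMinusB-⊗ k i p t = trans (coeff-⊗ (yMinusB k i) p (suc t)) (yMinusB-⊛ k i (coeff p) (suc t))

unitLeading-step : ∀ k i d p q → UnitLeading (suc d) p → VanishesAbove d q →
  UnitLeading (suc (suc d)) ((yMinusB k i ⊗ p) ⊕ q)
unitLeading-step k i d p q (unitLeading ∣lead∣≡1 p-vanishes) q-vanishes = unitLeading ∣lead′∣≡1 vanishes
  where
  coeff-step : ∀ t → coeff ((yMinusB k i ⊗ p) ⊕ q) (suc t)
                   ≡ - bCoef k i * coeff p (suc t) + sgn k * coeff p t + coeff q (suc t)
  coeff-step t = trans (coeff-⊕ (yMinusB k i ⊗ p) q (suc t)) (cong (_+ coeff q (suc t)) (coeff-yMinusB-⊗ k i p t))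
  ∣lead′∣≡1 : ∣ coeff ((yMinusB k i ⊗ p) ⊕ q) (suc (suc d)) ∣ ≡ 1
  ∣lead′∣≡1 rewrite coeff-step (suc d) | p-vanishes (suc (suc d)) ℕ.≤-refl
    | q-vanishes (suc (suc d)) (ℕ.m<n⇒m<1+n (ℕ.n<1+n d))
    = trans (cong ∣_∣ (only-middle (- bCoef k i) (sgn k * coeff p (suc d))))
            (trans (abs-* (sgn k) (coeff p (suc d))) (cong₂ ℕ._*_ (∣sgn∣≡1 k) ∣lead∣≡1))
    where
    only-middle : ∀ b x → b * 0ℤ + x + 0ℤ ≡ x
    only-middle = solve-∀
  vanishes : VanishesAbove (suc (suc d)) ((yMinusB k i ⊗ p) ⊕ q)
  vanishes (suc t) (s≤s 1+d<t) rewrite coeff-step t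
    | p-vanishes (suc t) (ℕ.m<n⇒m<1+n 1+d<t) | p-vanishes t 1+d<t
    | q-vanishes (suc t) (ℕ.<-trans (ℕ.n<1+n d) (ℕ.m<n⇒m<1+n 1+d<t))
    = all-zero (- bCoef k i) (sgn k)
    where
    all-zero : ∀ b s → b * 0ℤ + s * 0ℤ + 0ℤ ≡ 0ℤ
    all-zero = solve-∀

tail-degrees : ∀ k j → UnitLeading (suc j) (tailNum k j) × VanishesAbove j (tailDen k j)
tail-degrees k zero = unitLeading (∣sgn∣≡1 k) num-vanishes , den-vanishes
  where
  num-vanishes : VanishesAbove 1 (tailNum k 0)
  num-vanishes (suc (suc t)) _          = refl
  num-vanishes (suc zero)    (s≤s ())
  den-vanishes : VanishesAbove 0 (tailDen k 0)
  den-vanishes (suc t) _ = refl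
tail-degrees k (suc j) =
  let (num , den) = tail-degrees k j in
  unitLeading-step k (k ∸ suc j) j (tailNum k j) (tailDen k j) num den , UnitLeading.vanishes num


-- Counting alternating sequences

when : Bool → ℕ → ℕ
when true  n = n
when false n = 0

when-≤ᵇ-suc : ∀ b a x → when (b ≤ᵇ suc a) x ≡ when (b ≤ᵇ a) x ℕ.+ when (b ≡ᵇ suc a) x
when-≤ᵇ-suc zero          a       x = sym (ℕ.+-identityʳ x)
when-≤ᵇ-suc (suc zero)    zero    x = refl
when-≤ᵇ-suc (suc (suc b)) zero    x = refl
when-≤ᵇ-suc (suc zero)    (suc a) x = sym (ℕ.+-identityʳ x)
when-≤ᵇ-suc (suc (suc b)) (suc a) x = when-≤ᵇ-suc (suc b) a x

when-≤ᵇ-split : ∀ a b x → when (a ≤ᵇ b) x ≡ when (b ≡ᵇ a) x ℕ.+ when (suc a ≤ᵇ b) x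
when-≤ᵇ-split zero          zero    x = sym (ℕ.+-identityʳ x)
when-≤ᵇ-split zero          (suc b) x = refl
when-≤ᵇ-split (suc a)       zero    x = refl
when-≤ᵇ-split (suc zero)    (suc b) x = when-≤ᵇ-split zero b x
when-≤ᵇ-split (suc (suc a)) (suc b) x = when-≤ᵇ-split (suc a) b x

when-≤ᵇ-holds : ∀ a b x → a ≤ b → when (a ≤ᵇ b) x ≡ x
when-≤ᵇ-holds zero          b       x _         = refl
when-≤ᵇ-holds (suc zero)    (suc b) x _         = refl
when-≤ᵇ-holds (suc (suc a)) (suc b) x (s≤s a<b) = when-≤ᵇ-holds (suc a) b x a<b

when-≤ᵇ-fails : ∀ a b x → b < a → when (a ≤ᵇ b) x ≡ 0
when-≤ᵇ-fails (suc a)       zero    x _           = refl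
when-≤ᵇ-fails (suc (suc a)) (suc b) x (s≤s b<1+a) = when-≤ᵇ-fails (suc a) b x b<1+a

sumRange : ℕ → (ℕ → ℕ) → ℕ
sumRange K g = sum (map g (range1 K))

range1-suc : ∀ K → range1 (suc K) ≡ 1 ∷ map suc (range1 K)
range1-suc zero    = refl
range1-suc (suc K) = refl

sumRange-suc : ∀ K g → sumRange (suc K) g ≡ g 1 ℕ.+ sumRange K (g ∘ suc)
sumRange-suc K g rewrite range1-suc K = cong (λ xs → g 1 ℕ.+ sum xs) (sym (map-∘ (range1 K)))

sumRange-cong : ∀ K {g h} → (∀ b → 1 ≤ b → b ≤ K → g b ≡ h b) → sumRange K g ≡ sumRange K h
sumRange-cong zero    g≗h = refl
sumRange-cong (suc K) {g} {h} g≗h = begin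
  sumRange (suc K) g
    ≡⟨ sumRange-suc K g ⟩
  g 1 ℕ.+ sumRange K (g ∘ suc)
    ≡⟨ cong₂ ℕ._+_ (g≗h 1 (s≤s z≤n) (s≤s z≤n)) (sumRange-cong K (λ b _ b≤K → g≗h (suc b) (s≤s z≤n) (s≤s b≤K))) ⟩
  h 1 ℕ.+ sumRange K (h ∘ suc)
    ≡⟨ sym (sumRange-suc K h) ⟩
  sumRange (suc K) h ∎
  where open ≡-Reasoning

sum-map-+ : ∀ (g h : ℕ → ℕ) xs → sum (map (λ b → g b ℕ.+ h b) xs) ≡ sum (map g xs) ℕ.+ sum (map h xs)
sum-map-+ g h []       = refl
sum-map-+ g h (x ∷ xs) rewrite sum-map-+ g h xs = +-interchange (g x) (h x) (sum (map g xs)) (sum (map h xs))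

sumRange-vanishes : ∀ K {g} → (∀ b → 1 ≤ b → b ≤ K → g b ≡ 0) → sumRange K g ≡ 0
sumRange-vanishes K g≗0 = trans (sumRange-cong K g≗0) (sum-zeros (range1 K))
  where
  sum-zeros : ∀ xs → sum (map (λ _ → 0) xs) ≡ 0
  sum-zeros []       = refl
  sum-zeros (x ∷ xs) = sum-zeros xs

sumRange-pick : ∀ K c (h : ℕ → ℕ) → 1 ≤ c → c ≤ K → sumRange K (λ b → when (b ≡ᵇ c) (h b)) ≡ h c
sumRange-pick (suc K) (suc zero) h _ _ = begin
  sumRange (suc K) (λ b → when (b ≡ᵇ 1) (h b))           ≡⟨ sumRange-suc K (λ b → when (b ≡ᵇ 1) (h b)) ⟩
  h 1 ℕ.+ sumRange K (λ b → when (b ≡ᵇ 0) (h (suc b)))    ≡⟨ cong (h 1 ℕ.+_) (sumRange-vanishes K none) ⟩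
  h 1 ℕ.+ 0                                               ≡⟨ ℕ.+-identityʳ (h 1) ⟩
  h 1                                                     ∎
  where
  open ≡-Reasoning
  none : ∀ b → 1 ≤ b → b ≤ K → when (b ≡ᵇ 0) (h (suc b)) ≡ 0
  none (suc b) _ _ = refl
sumRange-pick (suc K) (suc (suc c)) h _ (s≤s c<K) =
  trans (sumRange-suc K (λ b → when (b ≡ᵇ suc (suc c)) (h b))) (sumRange-pick K (suc c) (h ∘ suc) (s≤s z≤n) c<K)

module _ (K : ℕ) (h : ℕ → ℕ) where

  sumRange-≤ᵇ-zero : sumRange K (λ b → when (b ≤ᵇ 0) (h b)) ≡ 0
  sumRange-≤ᵇ-zero = sumRange-vanishes K (λ b 1≤b _ → when-≤ᵇ-fails b 0 (h b) 1≤b)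

  sumRange-≤ᵇ-suc : ∀ a → suc a ≤ K →
    sumRange K (λ b → when (b ≤ᵇ suc a) (h b)) ≡ sumRange K (λ b → when (b ≤ᵇ a) (h b)) ℕ.+ h (suc a)
  sumRange-≤ᵇ-suc a a<K = begin
    sumRange K (λ b → when (b ≤ᵇ suc a) (h b))
      ≡⟨ cong sum (map-cong (λ b → when-≤ᵇ-suc b a (h b)) (range1 K)) ⟩
    sum (map (λ b → when (b ≤ᵇ a) (h b) ℕ.+ when (b ≡ᵇ suc a) (h b)) (range1 K))
      ≡⟨ sum-map-+ (λ b → when (b ≤ᵇ a) (h b)) (λ b → when (b ≡ᵇ suc a) (h b)) (range1 K) ⟩
    sumRange K (λ b → when (b ≤ᵇ a) (h b)) ℕ.+ sumRange K (λ b → when (b ≡ᵇ suc a) (h b))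
      ≡⟨ cong (sumRange K (λ b → when (b ≤ᵇ a) (h b)) ℕ.+_) (sumRange-pick K (suc a) h (s≤s z≤n) a<K) ⟩
    sumRange K (λ b → when (b ≤ᵇ a) (h b)) ℕ.+ h (suc a) ∎
    where open ≡-Reasoning

  sumRange-≤ᵇ-all : sumRange K (λ b → when (b ≤ᵇ K) (h b)) ≡ sumRange K h
  sumRange-≤ᵇ-all = sumRange-cong K (λ b _ b≤K → when-≤ᵇ-holds b K (h b) b≤K)

  sumRange-≥ᵇ-beyond : sumRange K (λ b → when (suc K ≤ᵇ b) (h b)) ≡ 0
  sumRange-≥ᵇ-beyond = sumRange-vanishes K (λ b _ b≤K → when-≤ᵇ-fails (suc K) b (h b) (s≤s b≤K))

  sumRange-≥ᵇ-step : ∀ a → 1 ≤ a → a ≤ K →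
    sumRange K (λ b → when (a ≤ᵇ b) (h b)) ≡ h a ℕ.+ sumRange K (λ b → when (suc a ≤ᵇ b) (h b))
  sumRange-≥ᵇ-step a 1≤a a≤K = begin
    sumRange K (λ b → when (a ≤ᵇ b) (h b))
      ≡⟨ cong sum (map-cong (λ b → when-≤ᵇ-split a b (h b)) (range1 K)) ⟩
    sum (map (λ b → when (b ≡ᵇ a) (h b) ℕ.+ when (suc a ≤ᵇ b) (h b)) (range1 K))
      ≡⟨ sum-map-+ (λ b → when (b ≡ᵇ a) (h b)) (λ b → when (suc a ≤ᵇ b) (h b)) (range1 K) ⟩
    sumRange K (λ b → when (b ≡ᵇ a) (h b)) ℕ.+ sumRange K (λ b → when (suc a ≤ᵇ b) (h b))
      ≡⟨ cong (ℕ._+ sumRange K (λ b → when (suc a ≤ᵇ b) (h b))) (sumRange-pick K a h 1≤a a≤K) ⟩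
    h a ℕ.+ sumRange K (λ b → when (suc a ≤ᵇ b) (h b)) ∎
    where open ≡-Reasoning

countWhere-++ : ∀ {A : Set} (P : A → Bool) xs ys → countWhere P (xs ++ ys) ≡ countWhere P xs ℕ.+ countWhere P ys
countWhere-++ P []       ys = refl
countWhere-++ P (x ∷ xs) ys with P x
... | true  = cong suc (countWhere-++ P xs ys)
... | false = countWhere-++ P xs ys

countWhere-concatMap : ∀ {A B : Set} (P : B → Bool) (f : A → List B) xs →
  countWhere P (concatMap f xs) ≡ sum (map (λ x → countWhere P (f x)) xs)
countWhere-concatMap P f []       = refl
countWhere-concatMap P f (x ∷ xs) =
  trans (countWhere-++ P (f x) (concatMap f xs)) (cong (countWhere P (f x) ℕ.+_) (countWhere-concatMap P f xs))

countWhere-map : ∀ {A B : Set} (P : B → Bool) (g : A → B) xs → countWhere P (map g xs) ≡ countWhere (P ∘ g) xs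
countWhere-map P g []       = refl
countWhere-map P g (x ∷ xs) with P (g x)
... | true  = cong suc (countWhere-map P g xs)
... | false = countWhere-map P g xs

countWhere-∧ : ∀ {A : Set} c (P : A → Bool) xs → countWhere (λ x → c ∧ P x) xs ≡ when c (countWhere P xs)
countWhere-∧ true  P xs = refl
countWhere-∧ false P xs = none xs
  where
  none : ∀ xs → countWhere (λ _ → false) xs ≡ 0
  none []       = refl
  none (x ∷ xs) = none xs

countWhere-seqs-suc : ∀ K n (P : List ℕ → Bool) →
  countWhere P (seqs K (suc n)) ≡ sumRange K (λ b → countWhere (λ s → P (b ∷ s)) (seqs K n))
countWhere-seqs-suc K n P =
  trans (countWhere-concatMap P (λ b → map (b ∷_) (seqs K n)) (range1 K))
        (cong sum (map-cong (λ b → countWhere-map P (b ∷_) (seqs K n)) (range1 K)))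

m∸n≡1+m∸[1+n] : ∀ {m n} → n < m → m ∸ n ≡ suc (m ∸ suc n)
m∸n≡1+m∸[1+n] {suc m} {zero}  _         = refl
m∸n≡1+m∸[1+n] {suc m} {suc n} (s≤s n<m) = m∸n≡1+m∸[1+n] n<m

module Counting (K : ℕ) where

  extensions : Bool → ℕ → ℕ → ℕ
  extensions up a n = countWhere (λ s → altFrom up (a ∷ s)) (seqs K n)

  extensions-false-suc : ∀ a n → extensions false a (suc n) ≡ sumRange K (λ b → when (b ≤ᵇ a) (extensions true b n))
  extensions-false-suc a n = trans (countWhere-seqs-suc K n (λ s → altFrom false (a ∷ s)))
    (cong sum (map-cong (λ b → countWhere-∧ (b ≤ᵇ a) (λ s → altFrom true (b ∷ s)) (seqs K n)) (range1 K)))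

  extensions-true-suc : ∀ a n → extensions true a (suc n) ≡ sumRange K (λ b → when (a ≤ᵇ b) (extensions false b n))
  extensions-true-suc a n = trans (countWhere-seqs-suc K n (λ s → altFrom true (a ∷ s)))
    (cong sum (map-cong (λ b → countWhere-∧ (a ≤ᵇ b) (λ s → altFrom false (b ∷ s)) (seqs K n)) (range1 K)))

  extensions-false-zero : ∀ n → extensions false 0 (suc n) ≡ 0
  extensions-false-zero n = trans (extensions-false-suc 0 n) (sumRange-≤ᵇ-zero K (λ b → extensions true b n))

  extensions-false-step : ∀ a n → suc a ≤ K →
    extensions false (suc a) (suc n) ≡ extensions false a (suc n) ℕ.+ extensions true (suc a) n
  extensions-false-step a n a<K = begin
    extensions false (suc a) (suc n)
      ≡⟨ extensions-false-suc (suc a) n ⟩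
    sumRange K (λ b → when (b ≤ᵇ suc a) (extensions true b n))
      ≡⟨ sumRange-≤ᵇ-suc K (λ b → extensions true b n) a a<K ⟩
    sumRange K (λ b → when (b ≤ᵇ a) (extensions true b n)) ℕ.+ extensions true (suc a) n
      ≡⟨ cong (ℕ._+ extensions true (suc a) n) (sym (extensions-false-suc a n)) ⟩
    extensions false a (suc n) ℕ.+ extensions true (suc a) n ∎
    where open ≡-Reasoning

  extensions-true-beyond : ∀ n → extensions true (suc K) (suc n) ≡ 0
  extensions-true-beyond n = trans (extensions-true-suc (suc K) n) (sumRange-≥ᵇ-beyond K (λ b → extensions false b n))

  extensions-true-step : ∀ a n → 1 ≤ a → a ≤ K →
    extensions true a (suc n) ≡ extensions false a n ℕ.+ extensions true (suc a) (suc n)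
  extensions-true-step a n 1≤a a≤K = begin
    extensions true a (suc n)
      ≡⟨ extensions-true-suc a n ⟩
    sumRange K (λ b → when (a ≤ᵇ b) (extensions false b n))
      ≡⟨ sumRange-≥ᵇ-step K (λ b → extensions false b n) a 1≤a a≤K ⟩
    extensions false a n ℕ.+ sumRange K (λ b → when (suc a ≤ᵇ b) (extensions false b n))
      ≡⟨ cong (extensions false a n ℕ.+_) (sym (extensions-true-suc (suc a) n)) ⟩
    extensions false a n ℕ.+ extensions true (suc a) (suc n) ∎
    where open ≡-Reasoning

  altCount≡extensions : ∀ n → altCount K (suc n) ≡ extensions false K (suc n)
  altCount≡extensions n = begin
    altCount K (suc n)                                               ≡⟨ countWhere-seqs-suc K n isAlt ⟩
    sumRange K (λ b → extensions true b n)                           ≡⟨ sym (sumRange-≤ᵇ-all K (λ b → extensions true b n)) ⟩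
    sumRange K (λ b → when (b ≤ᵇ K) (extensions true b n))           ≡⟨ sym (extensions-false-suc K n) ⟩
    extensions false K (suc n)                                       ∎
    where open ≡-Reasoning

  -- For 1 ≤ m ≤ K, fallCount n m = extensions false m n. The value fallCount 0 0 = 0,
  -- rather than 1, is the boundary condition under which the recurrences of FoldedCounts
  -- also hold at n = 0.
  fallCount : ℕ → ℕ → ℕ
  fallCount zero    zero    = 0
  fallCount zero    (suc m) = 1
  fallCount (suc n) zero    = 0
  fallCount (suc n) (suc m) = fallCount (suc n) m ℕ.+ fallCount n (K ∸ m)

  extensions-false≡fallCount : ∀ n a → 1 ≤ a → a ≤ K → extensions false a n ≡ fallCount n a
  extensions-true≡fallCount  : ∀ n j → j < K → extensions true (suc j) n ≡ fallCount n (K ∸ j)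
  extensions-false-suc≡fallCount : ∀ n a → a ≤ K → extensions false a (suc n) ≡ fallCount (suc n) a
  extensions-true-suc≡fallCount  : ∀ n t → t ≤ K → extensions true (suc (K ∸ t)) (suc n) ≡ fallCount (suc n) t

  extensions-false≡fallCount zero    (suc a) _ _   = refl
  extensions-false≡fallCount (suc n) a       _ a≤K = extensions-false-suc≡fallCount n a a≤K

  extensions-true≡fallCount zero    j j<K = sym (cong (fallCount 0) (m∸n≡1+m∸[1+n] j<K))
  extensions-true≡fallCount (suc n) j j<K =
    subst (λ a → extensions true (suc a) (suc n) ≡ fallCount (suc n) (K ∸ j))
          (ℕ.m∸[m∸n]≡n (ℕ.<⇒≤ j<K))
          (extensions-true-suc≡fallCount n (K ∸ j) (ℕ.m∸n≤m K j))

  extensions-false-suc≡fallCount n zero    _   = extensions-false-zero n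
  extensions-false-suc≡fallCount n (suc a) a<K =
    trans (extensions-false-step a n a<K)
          (cong₂ ℕ._+_ (extensions-false-suc≡fallCount n a (ℕ.<⇒≤ a<K)) (extensions-true≡fallCount n a a<K))

  extensions-true-suc≡fallCount n zero    _   = extensions-true-beyond n
  extensions-true-suc≡fallCount n (suc t) t<K = begin
    extensions true (suc (K ∸ suc t)) (suc n)
      ≡⟨ extensions-true-step (suc (K ∸ suc t)) n (s≤s z≤n) 1+a≤K ⟩
    extensions false (suc (K ∸ suc t)) n ℕ.+ extensions true (suc (suc (K ∸ suc t))) (suc n)
      ≡⟨ cong₂ (λ a b → extensions false a n ℕ.+ extensions true (suc b) (suc n)) (sym K∸t≡1+a) (sym K∸t≡1+a) ⟩
    extensions false (K ∸ t) n ℕ.+ extensions true (suc (K ∸ t)) (suc n)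
      ≡⟨ cong₂ ℕ._+_ (extensions-false≡fallCount n (K ∸ t) (subst (1 ≤_) (sym K∸t≡1+a) (s≤s z≤n)) (ℕ.m∸n≤m K t))
                     (extensions-true-suc≡fallCount n t (ℕ.<⇒≤ t<K)) ⟩
    fallCount n (K ∸ t) ℕ.+ fallCount (suc n) t
      ≡⟨ ℕ.+-comm (fallCount n (K ∸ t)) (fallCount (suc n) t) ⟩
    fallCount (suc n) (suc t) ∎
    where
    open ≡-Reasoning
    K∸t≡1+a : K ∸ t ≡ suc (K ∸ suc t)
    K∸t≡1+a = m∸n≡1+m∸[1+n] t<K
    1+a≤K : suc (K ∸ suc t) ≤ K
    1+a≤K = subst (_≤ K) K∸t≡1+a (ℕ.m∸n≤m K t)

  altCount≡fallCount : ∀ n → altCount K (suc n) ≡ fallCount (suc n) K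
  altCount≡fallCount n = trans (altCount≡extensions n) (extensions-false-suc≡fallCount n K ℕ.≤-refl)


-- The counting series solve the three-term recurrence

module FoldedCounts (k : ℕ) where

  open Counting (suc k) using (fallCount; altCount≡fallCount)

  σ : ℤ
  σ = sgn k

  F : ℕ → ℕ → ℤ
  F n m = ℤ.+ fallCount n m

  F-zero : ∀ n → F n 0 ≡ 0ℤ
  F-zero zero    = refl
  F-zero (suc n) = refl

  F-step : ∀ n t → F (suc n) (suc t) ≡ F (suc n) t + F n (suc k ∸ t)
  F-step n t = pos-+ (fallCount (suc n) t) (fallCount n (suc k ∸ t))

  F-step-top : ∀ n t → t < suc k → F (suc n) (suc k ∸ t) ≡ F (suc n) (suc k ∸ suc t) + F n (suc t)
  F-step-top n t t<K = begin
    F (suc n) (suc k ∸ t)                                      ≡⟨ cong (F (suc n)) (m∸n≡1+m∸[1+n] t<K) ⟩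
    F (suc n) (suc (suc k ∸ suc t))                            ≡⟨ F-step n (suc k ∸ suc t) ⟩
    F (suc n) (suc k ∸ suc t) + F n (suc k ∸ (suc k ∸ suc t))  ≡⟨ cong (λ m → F (suc n) (suc k ∸ suc t) + F n m) (ℕ.m∸[m∸n]≡n t<K) ⟩
    F (suc n) (suc k ∸ suc t) + F n (suc t)                    ∎
    where open ≡-Reasoning

  U : ℕ → ℕ → ℤ
  U i n = F n (suc k ∸ ⌊ i /2⌋) - F n ⌈ i /2⌉

  half<1+k : ∀ j → j ℕ.+ j ≤ k → j < suc k
  half<1+k j 2j≤k = s≤s (ℕ.≤-trans (ℕ.m≤m+n j j) 2j≤k)

  U-three-term : ∀ i n → i < k →
    U (suc (suc i)) (suc n) ≡ ℤ.+ 2 * U (suc i) (suc n) - sgn (suc i) * U (suc i) n - U i (suc n)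
  U-three-term i n i<k with evenOdd i
  ... | even j rewrite sym (ℕ.n≡⌊n+n/2⌋ j) | sym (ℕ.n≡⌈n+n/2⌉ j) | sgn-suc (j ℕ.+ j) | sgn-even j =
    odd-index (F (suc n) (suc k ∸ suc j)) (F (suc n) j) (F n (suc j)) (F n (suc k ∸ j))
      (F-step-top n j (half<1+k j (ℕ.<⇒≤ i<k))) (F-step n j)
    where
    odd-index : ∀ a b p q {x y} → x ≡ a + p → y ≡ b + q → a - y ≡ ℤ.+ 2 * (x - y) - - 1ℤ * (q - p) - (x - b)
    odd-index a b p q refl refl = ring a b p q
      where
      ring : ∀ a b p q → a - (b + q) ≡ ℤ.+ 2 * ((a + p) - (b + q)) - - 1ℤ * (q - p) - ((a + p) - b)
      ring = solve-∀
  ... | odd j rewrite sym (ℕ.n≡⌊n+n/2⌋ j) | sym (ℕ.n≡⌈n+n/2⌉ j) | sgn-even j =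
    even-index (F (suc n) (suc k ∸ suc j)) (F n (suc j)) (F n (suc k ∸ suc j)) (F (suc n) (suc j))
      (F-step-top n j (half<1+k j (ℕ.<⇒≤ (ℕ.<⇒≤ i<k)))) (F-step n (suc j))
    where
    even-index : ∀ a p r y {x z} → x ≡ a + p → z ≡ y + r → a - z ≡ ℤ.+ 2 * (a - y) - 1ℤ * (r - p) - (x - y)
    even-index a p r y refl refl = ring a p r y
      where
      ring : ∀ a p r y → a - (y + r) ≡ ℤ.+ 2 * (a - y) - 1ℤ * (r - p) - ((a + p) - y)
      ring = solve-∀

  -- Chosen so that − bᵢ₊₁ ε (suc i) = 2 ε (suc (suc i)), matching the factor 2 in U-three-term.
  ε : ℕ → ℤ
  ε zero    = 1ℤ
  ε (suc i) = - (sgn (k ∸ i) * ε i)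

  V : ℕ → ℕ → ℤ
  V i n = ε i * U i n

  V-three-term-zero : ∀ n → σ * V 0 n + - bCoef k 0 * V 0 (suc n) ≡ V 1 (suc n)
  V-three-term-zero n = base (F n (suc k)) (F (suc n) (suc k)) (F-zero n) (F-step n 0)
    where
    base : ∀ a a′ {z x} → z ≡ 0ℤ → x ≡ 0ℤ + a →
      σ * (1ℤ * (a - z)) + - σ * (1ℤ * (a′ - 0ℤ)) ≡ - (σ * 1ℤ) * (a′ - x)
    base a a′ refl refl = ring σ a a′
      where
      ring : ∀ σ a a′ → σ * (1ℤ * (a - 0ℤ)) + - σ * (1ℤ * (a′ - 0ℤ)) ≡ - (σ * 1ℤ) * (a′ - (0ℤ + a))
      ring = solve-∀

  V-three-term : ∀ i n → i < k →
    σ * V (suc i) n + - bCoef k (suc i) * V (suc i) (suc n) ≡ V (suc (suc i)) (suc n) - V i (suc n)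
  V-three-term i n i<k =
    combine σ (sgn (k ∸ i)) (sgn (k ∸ suc i)) (sgn (suc i)) (ε i) (U (suc i) n) (U (suc i) (suc n)) (U i (suc n))
            (U (suc (suc i)) (suc n)) (sym (sgn-∸ i<k)) sgn[k∸i]≡-sgn[k∸1+i] (U-three-term i n i<k) (sgn-square (k ∸ suc i))
    where
    sgn[k∸i]≡-sgn[k∸1+i] : sgn (k ∸ i) ≡ - sgn (k ∸ suc i)
    sgn[k∸i]≡-sgn[k∸1+i] = trans (cong sgn (m∸n≡1+m∸[1+n] i<k)) (sgn-suc (k ∸ suc i))
    combine : ∀ σ s₀ s c e u u′ u₋ u₊ → σ ≡ s * c → s₀ ≡ - s → u₊ ≡ ℤ.+ 2 * u′ - c * u - u₋ → s * s ≡ 1ℤ →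
      σ * (- (s₀ * e) * u) + - (ℤ.+ 2 * s) * (- (s₀ * e) * u′) ≡ - (s * - (s₀ * e)) * u₊ - e * u₋
    combine _ _ s c e u u′ u₋ _ refl refl refl s²≡1 = begin
      (s * c) * (- (- s * e) * u) + - (ℤ.+ 2 * s) * (- (- s * e) * u′)
        ≡⟨ ring s c e u u′ u₋ ⟩
      - (s * - (- s * e)) * (ℤ.+ 2 * u′ - c * u - u₋) - (s * s) * (e * u₋)
        ≡⟨ cong (λ t → - (s * - (- s * e)) * (ℤ.+ 2 * u′ - c * u - u₋) - t * (e * u₋)) s²≡1 ⟩
      - (s * - (- s * e)) * (ℤ.+ 2 * u′ - c * u - u₋) - 1ℤ * (e * u₋)
        ≡⟨ cong (λ t → - (s * - (- s * e)) * (ℤ.+ 2 * u′ - c * u - u₋) - t) (*-identityˡ (e * u₋)) ⟩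
      - (s * - (- s * e)) * (ℤ.+ 2 * u′ - c * u - u₋) - e * u₋ ∎
      where
      open ≡-Reasoning
      ring : ∀ s c e u u′ u₋ → (s * c) * (- (- s * e) * u) + - (ℤ.+ 2 * s) * (- (- s * e) * u′)
                              ≡ - (s * - (- s * e)) * (ℤ.+ 2 * u′ - c * u - u₋) - (s * s) * (e * u₋)
      ring = solve-∀

  V-initial : ∀ i → 1 ≤ i → i ≤ k → V i 0 ≡ 0ℤ
  V-initial (suc i) _ 1+i≤k = trans
    (cong (λ m → ε (suc i) * (F 0 m - 1ℤ)) (ℕ.+-∸-assoc 1 (ℕ.≤-trans (ℕ.⌊n/2⌋≤n (suc i)) 1+i≤k)))
    (*-zeroʳ (ε (suc i)))

  V-top : ∀ n → V (suc k) n ≡ 0ℤ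
  V-top n = trans (cong (λ m → ε (suc k) * (F n m - F n ⌈ suc k /2⌉)) K∸⌊K/2⌋≡⌈K/2⌉)
                  (trans (cong (ε (suc k) *_) (+-inverseʳ (F n ⌈ suc k /2⌉))) (*-zeroʳ (ε (suc k))))
    where
    K∸⌊K/2⌋≡⌈K/2⌉ : suc k ∸ ⌊ suc k /2⌋ ≡ ⌈ suc k /2⌉
    K∸⌊K/2⌋≡⌈K/2⌉ = trans (cong (_∸ ⌊ suc k /2⌋) (sym (ℕ.⌊n/2⌋+⌈n/2⌉≡n (suc k)))) (ℕ.m+n∸m≡n ⌊ suc k /2⌋ ⌈ suc k /2⌉)

  W : ℕ → Series
  W i n = V i (suc n)

  W-three-term : ∀ i → i < k → yMinusB k (suc i) ⊛ W (suc i) ≗ λ n → W (suc (suc i)) n - W i n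
  W-three-term i i<k n = begin
    (yMinusB k (suc i) ⊛ W (suc i)) n
      ≡⟨ yMinusB-⊛-tail k (suc i) (V (suc i)) (λ m → W (suc (suc i)) m - W i m) (λ m → V-three-term i m i<k) n ⟩
    W (suc (suc i)) n - W i n - σ * V (suc i) 0 * δ n
      ≡⟨ cong (λ v → W (suc (suc i)) n - W i n - σ * v * δ n) (V-initial (suc i) (s≤s z≤n) i<k) ⟩
    W (suc (suc i)) n - W i n - σ * 0ℤ * δ n
      ≡⟨ ring σ (W (suc (suc i)) n - W i n) (δ n) ⟩
    W (suc (suc i)) n - W i n ∎
    where
    open ≡-Reasoning
    ring : ∀ s x d → x - s * 0ℤ * d ≡ x
    ring = solve-∀

  W-zero : yMinusB k 0 ⊛ W 0 ≗ λ n → W 1 n - σ * δ n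
  W-zero n = trans (yMinusB-⊛-tail k 0 (V 0) (W 1) V-three-term-zero n)
                   (cong (λ c → W 1 n - c * δ n) (*-identityʳ σ))

  W-top : W (suc k) ≗ λ _ → 0ℤ
  W-top n = V-top (suc n)

  altGF≗shift-W₀ : altGF (suc k) ≗ shift (W 0)
  altGF≗shift-W₀ zero    = refl
  altGF≗shift-W₀ (suc n) = trans (cong ℤ.+_ (altCount≡fallCount n)) (ring (F (suc n) (suc k)))
    where
    ring : ∀ x → x ≡ 1ℤ * (x - 0ℤ)
    ring = solve-∀

contFrac-denominator-unitLeading : ∀ k → UnitLeading (suc (suc k)) (proj₂ (contFrac (suc k)))
contFrac-denominator-unitLeading k =
  let (num , den) = tail-degrees (suc k) k in unitLeading-step (suc k) 0 k (tailNum (suc k) k) (tailDen (suc k) k) num den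

contFrac-expands-altGF : ∀ k n →
  polyTimesSeries (proj₂ (contFrac (suc k))) (altGF (suc (suc k))) n ≡ coeff (proj₁ (contFrac (suc k))) n
contFrac-expands-altGF k n = begin
  polyTimesSeries D (altGF (suc (suc k))) n      ≡⟨ polyTimesSeries≗⊛ D (altGF (suc (suc k))) n ⟩
  (D ⊛ altGF (suc (suc k))) n                    ≡⟨ ⊛-cong D altGF≗shift-W₀ n ⟩
  (D ⊛ shift (W 0)) n                            ≡⟨ ⊛-shift D (W 0) n ⟩
  shift (D ⊛ W 0) n                              ≡⟨ shift-cong (denominator-⊛ k refl W-zero) n ⟩
  shift (λ m → - (sgn (suc k) * coeff P m)) n    ≡⟨ sym (coeff-negY⊗ (suc k) P n) ⟩
  coeff (proj₁ (contFrac (suc k))) n             ∎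
  where
  open ≡-Reasoning
  open FoldedCounts (suc k) using (W; W-three-term; W-top; W-zero; altGF≗shift-W₀)
  open Elimination (suc k) W W-three-term W-top using (denominator-⊛)
  D = proj₂ (contFrac (suc k))
  P = tailNum (suc k) k

corollary7p7 : (k : ℕ) → 1 ≤ k →
    ((j : ℕ) → j < k → NonZeroPoly (proj₁ (tailCF k j)))
    × NonZeroPoly (proj₂ (contFrac k))
    × ((n : ℕ) → polyTimesSeries (proj₂ (contFrac k)) (altGF (suc k)) n ≡ coeff (proj₁ (contFrac k)) n)
corollary7p7 (suc k) _ =
  (λ j _ → unitLeading⇒nonZero (proj₁ (tail-degrees (suc k) j))) ,
  unitLeading⇒nonZero (contFrac-denominator-unitLeading k) ,
  contFrac-expands-altGF k
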